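{- Let $P$ be a program modelled as below and let $k_{max}\ge1$. Suppose the shortest counterexample of $P$ has length $k$ with $1\le k\le k_{max}$. Then $\mathrm{kind}(P,k_{max},1)$ returns a counterexample, and it does so after at least $k$ iterations, i.e. not before the invocation $\mathrm{kind}(P,k_{max},k)$.
   Context: A program $P$ is modelled as a transition system given by a set $S$ of states, a set $\mathit{init}_P\subseteq S$ of initial states, a transition relation $tr_P\subseteq S\times S$, a safety property $\phi\subseteq S$ and a completeness predicate $\psi\subseteq S$. Terminated executions are modelled by stuttering: every state has at least one $tr_P$-successor, and $\psi(s)$ holds iff the only $tr_P$-successor of $s$ is $s$ itself (all loops have been exited). A path is a finite sequence $s_1,\dots,s_m$ ($m\ge1$) of states with $tr_P(s_i,s_{i+1})$ for $1\le i<m$; it is initial if $s_1\in\mathit{init}_P$. A state $s$ with $\neg\phi(s)$ is an error state. A counterexample is an initial path whose last state is an error state; its length is its number of states. $\emptyset$ denotes the empty sequence. Checks for a bound $k\ge1$ (each may return any witness satisfying its condition): - $\mathrm{base\_case}_k(P)$: if there is an initial path $s_1,\dots,s_k$ and an index $1\le i\le k$ with $\neg\phi(s_i)$, return $[s_1,\dots,s_i]$; otherwise return $\emptyset$. - $\mathrm{forward\_condition}_k(P)$: if there is an initial path $s_1,\dots,s_k$ with $\neg\psi(s_k)$, return $[s_1,\dots,s_k]$; otherwise return $\emptyset$. - $\mathrm{inductive\_step}_k(P)$: if there are states $t_0,\dots,t_k\in S$ (not necessarily initial or reachable) with $tr_P(t_i,t_{i+1})$ and $\phi(t_i)$ for all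 $0\le i<k$ and $\neg\phi(t_k)$, return $[t_0,\dots,t_k]$; otherwise return $\emptyset$. Algorithm $\mathrm{kind}(P,k_{max},k)$: if $k>k_{max}$ return $\mathit{unknown}$; let $\pi:=\mathrm{base\_case}_k(P)$, and if $\pi\neq\emptyset$ return $\pi$; let $\pi:=\mathrm{forward\_condition}_k(P)$, and if $\pi=\emptyset$ return $\emptyset$; let $\pi:=\mathrm{inductive\_step}_k(P)$, and if $\pi=\emptyset$ return $\emptyset$; otherwise return $\mathrm{kind}(P,k_{max},k+1)$. The invocation with third argument $k$ is called the $k$-th iteration. -}

module Defs where

open import Data.Nat using (ℕ; zero; suc; _≤_; _<_; _∸_; _<?_)
open import Data.List using (List; []; _∷_; _++_; length; take)
open import Data.List.Relation.Unary.All using (All)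
open import Data.List.Relation.Unary.Linked using (Linked)
open import Data.Product using (Σ; ∃; ∃-syntax; _×_; _,_)
open import Data.Sum using (_⊎_)
open import Data.Empty using (⊥)
open import Relation.Nullary using (¬_; yes; no)
open import Relation.Binary.PropositionalEquality using (_≡_)

record Program (S : Set) : Set₁ where
  field
    init : S → Set
    tr   : S → S → Set
    φ    : S → Set
    ψ    : S → Set
    -- stuttering model of termination
    total      : ∀ s → ∃[ t ] tr s t
    ψ-stutter  : ∀ s → (ψ s → (∀ t → tr s t → t ≡ s)) × ((∀ t → tr s t → t ≡ s) → ψ s)

module _ {S : Set} (P : Program S) where
  open Program P

  LastSat : (S → Set) → List S → Set
  LastSat Q π = ∃[ ts ] ∃[ t ] (π ≡ ts ++ t ∷ [] × Q t)

  IsPath : List S → Set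
  IsPath []      = ⊥
  IsPath (s ∷ π) = Linked tr (s ∷ π)

  IsInitialPath : List S → Set
  IsInitialPath []      = ⊥
  IsInitialPath (s ∷ π) = init s × Linked tr (s ∷ π)

  IsCounterexample : List S → Set
  IsCounterexample π = IsInitialPath π × LastSat (λ s → ¬ φ s) π

  BaseWitness : ℕ → List S → Set
  BaseWitness k π = ∃[ ρ ] (IsInitialPath ρ × length ρ ≡ k ×
                      ∃[ i ] (1 ≤ i × i ≤ k × π ≡ take i ρ × LastSat (λ s → ¬ φ s) π))

  ForwardWitness : ℕ → List S → Set
  ForwardWitness k π = IsInitialPath π × length π ≡ k × LastSat (λ s → ¬ ψ s) π

  InductiveWitness : ℕ → List S → Set
  InductiveWitness k π = ∃[ ts ] ∃[ t ] (π ≡ ts ++ t ∷ [] × length ts ≡ k ×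
                           IsPath π × All φ ts × ¬ φ t)

  CheckSpec : (ℕ → List S → Set) → (ℕ → List S) → Set
  CheckSpec W c = ∀ k → 1 ≤ k →
    (c k ≡ [] × ¬ (∃[ π ] W k π)) ⊎ W k (c k)

  record Checks : Set where
    field
      base-case         : ℕ → List S
      forward-condition : ℕ → List S
      inductive-step    : ℕ → List S
      base-spec    : CheckSpec BaseWitness base-case
      forward-spec : CheckSpec ForwardWitness forward-condition
      inductive-spec : CheckSpec InductiveWitness inductive-step

  data Result : Set where
    unknown  : Result
    returned : List S → Result     -- returned [] means ∅

  -- kind(P, kmax, k): returns the result together with the index of the
  -- iteration (invocation) at which the result was returned.
  -- The fuel argument only ensures structural termination; kindFrom supplies
  -- enough fuel (kmax + 2 - k) that it is never exhausted.
  module _ (C : Checks) (kmax : ℕ) where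
    open Checks C

    kindFuel : ℕ → ℕ → Result × ℕ
    kindFuel zero    k = unknown , k
    kindFuel (suc n) k with kmax <? k
    ... | yes _ = unknown , k
    ... | no  _ with base-case k
    ...   | x ∷ xs = returned (x ∷ xs) , k
    ...   | [] with forward-condition k
    ...     | [] = returned [] , k
    ...     | _ ∷ _ with inductive-step k
    ...       | [] = returned [] , k
    ...       | _ ∷ _ = kindFuel n (suc k)

    kind : ℕ → Result × ℕ
    kind k = kindFuel (suc (suc kmax ∸ k)) k

  ShortestCexLength : ℕ → Set
  ShortestCexLength k = (∃[ π ] (IsCounterexample π × length π ≡ k)) ×
                        (∀ π → IsCounterexample π → k ≤ length π)

-- Fix a shortest counterexample ts ++ [e], of length k.  For every bound i < k:
-- base_case_i finds nothing, since its witnesses are counterexamples of length ≤ i;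
-- forward_condition_i succeeds on the prefix of length i, whose last state t is not
-- complete, for otherwise the program stutters at t, so t = e and a shorter
-- counterexample exists; inductive_step_i succeeds on the last i + 1 states, all but
-- the last of which are safe by minimality.  So kind passes iterations 1, …, k − 1
-- and at iteration k base_case_k returns a counterexample.
module Submission where

open import Defs
open import Data.Nat using (ℕ; zero; suc; _≤_; _<_; _∸_; _<?_; _+_; z≤n; s≤s; s≤s⁻¹)
open import Data.Nat.Properties
open import Data.List using (List; []; _∷_; _++_; _∷ʳ_; length; take; drop)
open import Data.List.Properties using (length-++; ++-assoc; ∷ʳ-++; take-all; take++drop≡id; length-take; length-drop)
open import Data.List.Relation.Unary.All using (All; []; _∷_)
open import Data.List.Relation.Unary.All.Properties using (++⁻ʳ)
open import Data.List.Relation.Unary.Linked using (Linked; []; [-]; _∷_; tail)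
open import Data.Product using (∃; ∃-syntax; _×_; _,_; proj₁)
open import Data.Sum using (inj₁; inj₂)
open import Data.Empty using (⊥-elim)
open import Relation.Nullary using (¬_; yes; no)
open import Relation.Nullary.Negation using (¬¬-map)
open import Relation.Binary.PropositionalEquality

module _ {A : Set} where

  ++-∷-≢-[] : ∀ (xs : List A) {y ys} → xs ++ y ∷ ys ≢ []
  ++-∷-≢-[] []      ()
  ++-∷-≢-[] (_ ∷ _) ()

  length-∷ʳ : ∀ (xs : List A) x → length (xs ∷ʳ x) ≡ suc (length xs)
  length-∷ʳ xs x = trans (length-++ xs) (+-comm (length xs) 1)

  ∷-splitAt : ∀ n (xs : List A) → n < length xs →
              ∃[ a ] ∃[ x ] ∃[ b ] (xs ≡ a ++ x ∷ b × length a ≡ n)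
  ∷-splitAt zero    (x ∷ xs) _         = [] , x , xs , refl , refl
  ∷-splitAt (suc n) (y ∷ xs) (s≤s n<) with ∷-splitAt n xs n<
  ... | a , x , b , xs≡ , |a|≡n = y ∷ a , x , b , cong (y ∷_) xs≡ , cong suc |a|≡n

  ¬¬-All : ∀ {P : A → Set} xs → (∀ a x b → xs ≡ a ++ x ∷ b → ¬ ¬ P x) → ¬ ¬ All P xs
  ¬¬-All []       _    ¬all = ¬all []
  ¬¬-All (x ∷ xs) ¬¬Px ¬all =
    ¬¬Px [] x xs refl λ Px →
      ¬¬-All xs (λ a y b xs≡ → ¬¬Px (x ∷ a) y b (cong (x ∷_) xs≡)) (λ all → ¬all (Px ∷ all))

module _ {A : Set} {R : A → A → Set} where

  linked-++⁻ˡ : ∀ xs {ys} → Linked R (xs ++ ys) → Linked R xs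
  linked-++⁻ˡ []           _       = []
  linked-++⁻ˡ (x ∷ [])     _       = [-]
  linked-++⁻ˡ (x ∷ y ∷ xs) (r ∷ l) = r ∷ linked-++⁻ˡ (y ∷ xs) l

  linked-++⁻ʳ : ∀ xs {ys} → Linked R (xs ++ ys) → Linked R ys
  linked-++⁻ʳ []       l = l
  linked-++⁻ʳ (_ ∷ xs) l = linked-++⁻ʳ xs (tail l)

module _ {S : Set} (P : Program S) where
  open Program P

  initialPath-linked : ∀ π → IsInitialPath P π → Linked tr π
  initialPath-linked (_ ∷ _) (_ , l) = l

  initialPath-++⁻ˡ : ∀ xs {ys} → xs ≢ [] → IsInitialPath P (xs ++ ys) → IsInitialPath P xs
  initialPath-++⁻ˡ []       xs≢[] _       = ⊥-elim (xs≢[] refl)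
  initialPath-++⁻ˡ (x ∷ xs) _     (i , l) = i , linked-++⁻ˡ (x ∷ xs) l

  initialPath-∷ʳ⁻ : ∀ a x {d} → IsInitialPath P (a ++ x ∷ d) → IsInitialPath P (a ∷ʳ x)
  initialPath-∷ʳ⁻ a x {d} path =
    initialPath-++⁻ˡ (a ∷ʳ x) (++-∷-≢-[] a) (subst (IsInitialPath P) (sym (∷ʳ-++ a x d)) path)

  path-∷ʳ : ∀ xs {x} → Linked tr (xs ∷ʳ x) → IsPath P (xs ∷ʳ x)
  path-∷ʳ []      l = l
  path-∷ʳ (_ ∷ _) l = l

  initialPath-≢-[] : ∀ {π} → IsInitialPath P π → π ≢ []
  initialPath-≢-[] {_ ∷ _} _ ()

  lastSat-≢-[] : ∀ {Q π} → LastSat P Q π → π ≢ []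
  lastSat-≢-[] (ts , _ , refl , _) = ++-∷-≢-[] ts

  ψ-stuck : ∀ {t} xs {y} → ψ t → Linked tr (t ∷ xs ∷ʳ y) → y ≡ t
  ψ-stuck []       ψt (r ∷ _) = proj₁ (ψ-stutter _) ψt _ r
  ψ-stuck (x ∷ xs) ψt (r ∷ l) with proj₁ (ψ-stutter _) ψt x r
  ... | refl = ψ-stuck xs ψt l

  base-witness-counterexample : ∀ {i π} → BaseWitness P i π → IsCounterexample P π × length π ≤ i
  base-witness-counterexample (ρ , path , _ , i′ , _ , i′≤i , refl , last) =
    (initialPath-++⁻ˡ (take i′ ρ) (lastSat-≢-[] last)
       (subst (IsInitialPath P) (sym (take++drop≡id i′ ρ)) path) , last) ,
    ≤-trans (≤-reflexive (length-take i′ ρ)) (≤-trans (m⊓n≤m i′ (length ρ)) i′≤i)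

  module _ {W : ℕ → List S → Set} {c : ℕ → List S} (spec : CheckSpec P W c) {i : ℕ} (1≤i : 1 ≤ i) where

    check-sound : c i ≢ [] → W i (c i)
    check-sound c≢[] with spec i 1≤i
    ... | inj₁ (c≡[] , _) = ⊥-elim (c≢[] c≡[])
    ... | inj₂ w          = w

    check-empty : ¬ ∃ (W i) → c i ≡ []
    check-empty ¬w with spec i 1≤i
    ... | inj₁ (c≡[] , _) = c≡[]
    ... | inj₂ w          = ⊥-elim (¬w (c i , w))

    check-nonempty : (∀ {π} → W i π → π ≢ []) → ¬ ¬ ∃ (W i) → c i ≢ []
    check-nonempty nonempty ¬¬w c≡[] with spec i 1≤i
    ... | inj₁ (_ , ¬w) = ¬¬w ¬w
    ... | inj₂ w        = nonempty w c≡[]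

  module _ (C : Checks P) (kmax : ℕ) where
    open Checks C

    kindFuel-stop : ∀ n {i} → i ≤ kmax → base-case i ≢ [] →
                    kindFuel P C kmax (suc n) i ≡ (returned (base-case i) , i)
    kindFuel-stop n {i} i≤kmax base≢[] with kmax <? i
    ... | yes kmax<i = ⊥-elim (<⇒≱ kmax<i i≤kmax)
    ... | no _ with base-case i
    ...   | []    = ⊥-elim (base≢[] refl)
    ...   | _ ∷ _ = refl

    kindFuel-continue : ∀ n {i} → i ≤ kmax → base-case i ≡ [] →
                        forward-condition i ≢ [] → inductive-step i ≢ [] →
                        kindFuel P C kmax (suc n) i ≡ kindFuel P C kmax n (suc i)
    kindFuel-continue n {i} i≤kmax base≡[] fwd≢[] ind≢[] with kmax <? i
    ... | yes kmax<i = ⊥-elim (<⇒≱ kmax<i i≤kmax)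
    ... | no _ rewrite base≡[] with forward-condition i
    ...   | []    = ⊥-elim (fwd≢[] refl)
    ...   | _ ∷ _ with inductive-step i
    ...     | []    = ⊥-elim (ind≢[] refl)
    ...     | _ ∷ _ = refl

  module ShortestCounterexample {k : ℕ} (minimal : ∀ π → IsCounterexample P π → k ≤ length π)
    {ts : List S} {e : S} (path : IsInitialPath P (ts ∷ʳ e)) (¬φe : ¬ φ e)
    (length≡k : length (ts ∷ʳ e) ≡ k) where

    1+length-ts≡k : suc (length ts) ≡ k
    1+length-ts≡k = trans (sym (length-∷ʳ ts e)) length≡k

    1≤k : 1 ≤ k
    1≤k = subst (1 ≤_) 1+length-ts≡k (s≤s z≤n)

    counterexample-split : ∀ {a x b} → ts ≡ a ++ x ∷ b → ts ∷ʳ e ≡ a ++ x ∷ (b ∷ʳ e)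
    counterexample-split {a} {x} {b} refl = ++-assoc a (x ∷ b) _

    safe-before-end : ∀ a x b → ts ≡ a ++ x ∷ b → ¬ ¬ φ x
    safe-before-end a x b ts≡ ¬φx = m+1+n≰m (length (a ∷ʳ x)) (begin
      length (a ∷ʳ x) + suc (length b)      ≡⟨ cong (length (a ∷ʳ x) +_) (length-∷ʳ b e) ⟨
      length (a ∷ʳ x) + length (b ∷ʳ e)     ≡⟨ length-++ (a ∷ʳ x) ⟨
      length ((a ∷ʳ x) ++ b ∷ʳ e)           ≡⟨ cong length (trans (counterexample-split ts≡) (sym (∷ʳ-++ a x _))) ⟨
      length (ts ∷ʳ e)                       ≡⟨ length≡k ⟩
      k                                      ≤⟨ minimal (a ∷ʳ x) (prefix , a , x , refl , ¬φx) ⟩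
      length (a ∷ʳ x)                        ∎)
      where
        open ≤-Reasoning
        prefix : IsInitialPath P (a ∷ʳ x)
        prefix = initialPath-∷ʳ⁻ a x (subst (IsInitialPath P) (counterexample-split ts≡) path)

    base-witness : ∃ (BaseWitness P k)
    base-witness = ts ∷ʳ e , ts ∷ʳ e , path , length≡k , k , 1≤k , ≤-refl ,
                   sym (take-all k (ts ∷ʳ e) (≤-reflexive length≡k)) , ts , e , refl , ¬φe

    forward-witness : ∀ n → suc n < k → ∃ (ForwardWitness P (suc n))
    forward-witness n 1+n<k with ∷-splitAt n ts (s≤s⁻¹ (≤-trans 1+n<k (≤-reflexive (sym 1+length-ts≡k))))
    ... | a , t , b , ts≡ , |a|≡n =
      a ∷ʳ t , initialPath-∷ʳ⁻ a t path′ , trans (length-∷ʳ a t) (cong suc |a|≡n) , a , t , refl , ¬ψt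
      where
        path′ : IsInitialPath P (a ++ t ∷ (b ∷ʳ e))
        path′ = subst (IsInitialPath P) (counterexample-split ts≡) path
        ¬ψt : ¬ ψ t
        ¬ψt ψt = safe-before-end a t b ts≡
          (subst (λ s → ¬ φ s) (ψ-stuck b ψt (linked-++⁻ʳ a (initialPath-linked _ path′))) ¬φe)

    -- φ is not decidable, so the witness is only available under ¬ ¬; this suffices
    -- because check-nonempty merely refutes that the check returns ∅.
    inductive-witness : ∀ i → i < k → ¬ ¬ ∃ (InductiveWitness P i)
    inductive-witness i i<k = ¬¬-map witness (¬¬-All ts safe-before-end)
      where
        m : ℕ
        m = length ts ∸ i
        ts≡ : ts ≡ take m ts ++ drop m ts
        ts≡ = sym (take++drop≡id m ts)
        length-suffix : length (drop m ts) ≡ i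
        length-suffix = trans (length-drop m ts)
          (m∸[m∸n]≡n (s≤s⁻¹ (≤-trans i<k (≤-reflexive (sym 1+length-ts≡k)))))
        suffix-linked : Linked tr (drop m ts ∷ʳ e)
        suffix-linked = linked-++⁻ʳ (take m ts)
          (subst (Linked tr) (trans (cong (_∷ʳ e) ts≡) (++-assoc (take m ts) (drop m ts) _))
            (initialPath-linked _ path))
        witness : All φ ts → ∃ (InductiveWitness P i)
        witness all = drop m ts ∷ʳ e , drop m ts , e , refl , length-suffix ,
                      path-∷ʳ (drop m ts) suffix-linked , ++⁻ʳ (take m ts) (subst (All φ) ts≡ all) , ¬φe

    module _ (C : Checks P) (kmax : ℕ) (k≤kmax : k ≤ kmax) where
      open Checks C

      base-case-empty : ∀ {i} → 1 ≤ i → i < k → base-case i ≡ []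
      base-case-empty 1≤i i<k = check-empty base-spec 1≤i λ (π , w) →
        let (cex , |π|≤i) = base-witness-counterexample w in <⇒≱ (≤-<-trans |π|≤i i<k) (minimal π cex)

      base-case-nonempty : base-case k ≢ []
      base-case-nonempty = check-nonempty base-spec 1≤k
        (λ (_ , _ , _ , _ , _ , _ , _ , last) → lastSat-≢-[] last) (λ ¬w → ¬w base-witness)

      forward-condition-nonempty : ∀ {i} → 1 ≤ i → i < k → forward-condition i ≢ []
      forward-condition-nonempty {suc n} 1≤i i<k = check-nonempty forward-spec 1≤i
        (λ (path , _) → initialPath-≢-[] path) (λ ¬w → ¬w (forward-witness n i<k))

      inductive-step-nonempty : ∀ {i} → 1 ≤ i → i < k → inductive-step i ≢ []
      inductive-step-nonempty {i} 1≤i i<k = check-nonempty inductive-spec 1≤i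
        (λ { (ts′ , _ , refl , _) → ++-∷-≢-[] ts′ }) (inductive-witness i i<k)

      base-case-counterexample : IsCounterexample P (base-case k)
      base-case-counterexample =
        proj₁ (base-witness-counterexample (check-sound base-spec 1≤k base-case-nonempty))

      kindFuel-reaches-k : ∀ n i → 1 ≤ i → i ≤ k → k ≤ i + n →
                           kindFuel P C kmax (suc n) i ≡ (returned (base-case k) , k)
      kindFuel-reaches-k n i 1≤i i≤k k≤i+n with m≤n⇒m<n∨m≡n i≤k
      ... | inj₂ refl = kindFuel-stop C kmax n k≤kmax base-case-nonempty
      kindFuel-reaches-k zero i _ _ k≤i+0 | inj₁ i<k =
        ⊥-elim (<⇒≱ i<k (≤-trans k≤i+0 (≤-reflexive (+-identityʳ i))))
      kindFuel-reaches-k (suc n) i 1≤i _ k≤i+1+n | inj₁ i<k = trans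
        (kindFuel-continue C kmax (suc n) (≤-trans (<⇒≤ i<k) k≤kmax) (base-case-empty 1≤i i<k)
          (forward-condition-nonempty 1≤i i<k) (inductive-step-nonempty 1≤i i<k))
        (kindFuel-reaches-k n (suc i) (s≤s z≤n) i<k (≤-trans k≤i+1+n (≤-reflexive (+-suc i n))))

      kind-returns-counterexample : ∃[ π ] (kind P C kmax 1 ≡ (returned π , k) × IsCounterexample P π)
      kind-returns-counterexample = base-case k ,
        kindFuel-reaches-k kmax 1 ≤-refl 1≤k (m≤n⇒m≤1+n k≤kmax) ,
        base-case-counterexample

theorem2 : {S : Set} (P : Program S) (C : Checks P) (kmax k : ℕ) →
    1 ≤ kmax → 1 ≤ k → k ≤ kmax → ShortestCexLength P k →
    (r : Result P) (j : ℕ) → kind P C kmax 1 ≡ (r , j) →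
    ∃[ π ] (r ≡ returned π × IsCounterexample P π × k ≤ j)
theorem2 P C kmax k _ _ k≤kmax ((_ , (path , _ , _ , refl , ¬φe) , length≡k) , minimal) r j kind≡
  with ShortestCounterexample.kind-returns-counterexample P minimal path ¬φe length≡k C kmax k≤kmax
... | π , kind≡′ , cex with trans (sym kind≡) kind≡′
... | refl = π , refl , cex , ≤-refl
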